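{- For every positive integer $n$, $$\xi_{n,q}(2)=1+\frac{1}{q}+\frac{1}{q^2}\,\xi_{n,q}.$$
   Context: Let $p$ be an odd prime, $\mathbb{C}_p$ the completion of an algebraic closure of $\mathbb{Q}_p$, and $q\in\mathbb{C}_p$ with $|1-q|_p<1$ (so $q^x$ is defined for $x\in\mathbb{Z}_p$). Put $[x]_q=\frac{1-q^x}{1-q}$. The $q$-Euler numbers $\xi_{n,q}$ are defined by $\xi_{0,q}=1$ and, for $n\ge 1$, $q\sum_{l=0}^{n}\binom{n}{l}q^l\xi_{l,q}+\xi_{n,q}=0$ (i.e. $q(q\xi+1)^n+\xi_{n,q}=0$ with the umbral convention $\xi^l\mapsto\xi_{l,q}$). The $q$-Euler polynomials are $\xi_{n,q}(x)=\sum_{l=0}^{n}\binom{n}{l}[x]_q^{\,n-l}q^{lx}\xi_{l,q}$ for $n\ge0$. -}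

module Defs where

open import Algebra.Bundles using (CommutativeRing)
open import Data.Nat using (ℕ; zero; suc; _∸_; _≤_)
import Data.Nat as ℕ
open import Data.Nat.Combinatorics using (_C_)
open import Data.Product using (_×_)

-- Everything is stated over an arbitrary commutative ring R (standing in for ℂ_p).
module QEuler {c ℓ} (R : CommutativeRing c ℓ) where
  open CommutativeRing R

  pow : Carrier → ℕ → Carrier
  pow a zero    = 1#
  pow a (suc n) = a * pow a n

  fromℕ : ℕ → Carrier
  fromℕ zero    = 0#
  fromℕ (suc k) = 1# + fromℕ k

  sumTo : ℕ → (ℕ → Carrier) → Carrier
  sumTo zero    f = f 0
  sumTo (suc n) f = sumTo n f + f (suc n)

  -- [x]_q = (1 - q^x)/(1 - q) = 1 + q + ... + q^(x-1)   (for x ∈ ℕ)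
  qint : Carrier → ℕ → Carrier
  qint q zero    = 0#
  qint q (suc x) = qint q x + pow q x

  IsQEulerNumbers : Carrier → (ℕ → Carrier) → Set ℓ
  IsQEulerNumbers q ξ =
    (ξ 0 ≈ 1#) ×
    (∀ n → 1 ≤ n →
      q * sumTo n (λ l → fromℕ (n C l) * pow q l * ξ l) + ξ n ≈ 0#)

  qEulerPoly : Carrier → (ℕ → Carrier) → ℕ → ℕ → Carrier
  qEulerPoly q ξ n x =
    sumTo n (λ l → fromℕ (n C l) * pow (qint q x) (n ∸ l) * pow q (l ℕ.* x) * ξ l)

{-# OPTIONS --safe #-}
module Submission where

-- Write Pₖ = Σₗ (k choose l) qˡ ξₗ, so that q Pₖ + ξₖ = 0 for k ≥ 1 and P₀ = 1.
-- Since [2]_q = 1 + q, the umbral identity (1 + q(1 + qξ))ⁿ = ((1 + q) + q²ξ)ⁿ gives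
-- ξₙ(2) = Σₖ (n choose k) qᵏ Pₖ =: S.  Replacing each q Pₖ by -ξₖ for k ≥ 1 yields
-- q S + Pₙ = q + 1, and multiplying by q gives q² S = q² + q + ξₙ.

open import Defs
open import Algebra.Bundles using (CommutativeRing)
open import Data.Nat using (ℕ; zero; suc; _∸_; _≤_; _≤?_; z≤n; s≤s)
import Data.Nat as ℕ
open import Data.Nat.Properties using (≰⇒>; +-∸-assoc; n<1+n)
open import Data.Nat.Combinatorics using (_C_; nCk+nC[k+1]≡[n+1]C[k+1]; k>n⇒nCk≡0)
open import Data.Product using (Σ)
open import Function using (_∘_)
import Relation.Binary.PropositionalEquality as ≡
open import Relation.Nullary using (yes; no)

module BinomialTransform {c ℓ} (R : CommutativeRing c ℓ) where
  open CommutativeRing R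
  open QEuler R
  open import Algebra.Solver.Ring.NaturalCoefficients.Default commutativeSemiring
  open import Relation.Binary.Reasoning.Setoid setoid

  sumTo-cong : ∀ n {f g : ℕ → Carrier} → (∀ l → f l ≈ g l) → sumTo n f ≈ sumTo n g
  sumTo-cong zero    f≈g = f≈g 0
  sumTo-cong (suc n) f≈g = +-cong (sumTo-cong n f≈g) (f≈g (suc n))

  sumTo-distrib-+ : ∀ n (f g : ℕ → Carrier) →
                    sumTo n (λ l → f l + g l) ≈ sumTo n f + sumTo n g
  sumTo-distrib-+ zero    f g = refl
  sumTo-distrib-+ (suc n) f g = begin
    sumTo n (λ l → f l + g l) + (f (suc n) + g (suc n))
      ≈⟨ +-congʳ (sumTo-distrib-+ n f g) ⟩
    (sumTo n f + sumTo n g) + (f (suc n) + g (suc n))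
      ≈⟨ solve 4 (λ a b x y → (a :+ b) :+ (x :+ y) := (a :+ x) :+ (b :+ y)) refl _ _ _ _ ⟩
    (sumTo n f + f (suc n)) + (sumTo n g + g (suc n)) ∎

  sumTo-*ˡ : ∀ n (k : Carrier) (f : ℕ → Carrier) → sumTo n (λ l → k * f l) ≈ k * sumTo n f
  sumTo-*ˡ zero    k f = refl
  sumTo-*ˡ (suc n) k f = trans (+-congʳ (sumTo-*ˡ n k f)) (sym (distribˡ k _ _))

  sumTo-zero : ∀ n {f : ℕ → Carrier} → (∀ l → f l ≈ 0#) → sumTo n f ≈ 0#
  sumTo-zero zero    f≈0 = f≈0 0
  sumTo-zero (suc n) f≈0 = trans (+-cong (sumTo-zero n f≈0) (f≈0 (suc n))) (+-identityˡ 0#)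

  sumTo-suc-head : ∀ n (f : ℕ → Carrier) → sumTo (suc n) f ≈ f 0 + sumTo n (f ∘ suc)
  sumTo-suc-head zero    f = refl
  sumTo-suc-head (suc n) f = trans (+-congʳ (sumTo-suc-head n f)) (+-assoc _ _ _)

  fromℕ-+ : ∀ m n → fromℕ (m ℕ.+ n) ≈ fromℕ m + fromℕ n
  fromℕ-+ zero    n = sym (+-identityˡ _)
  fromℕ-+ (suc m) n = trans (+-congˡ (fromℕ-+ m n)) (sym (+-assoc _ _ _))

  pow-cong : ∀ {a b} k → a ≈ b → pow a k ≈ pow b k
  pow-cong zero    a≈b = refl
  pow-cong (suc k) a≈b = *-cong a≈b (pow-cong k a≈b)

  pow-1# : ∀ k → pow 1# k ≈ 1#
  pow-1# zero    = refl
  pow-1# (suc k) = trans (*-identityˡ _) (pow-1# k)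

  pow-*2 : ∀ a l → pow a (l ℕ.* 2) ≈ pow (a * a) l
  pow-*2 a zero    = refl
  pow-*2 a (suc l) = trans (sym (*-assoc _ _ _)) (*-congˡ (pow-*2 a l))

  -- binomialTransform a n y z is the umbral power (y + z a)ⁿ, with aˡ read as a l.
  -- binomialTerm keeps the exponent d of y apart from n, since multiplying by y raises d alone.
  binomialTerm : (ℕ → Carrier) → ℕ → ℕ → Carrier → Carrier → ℕ → Carrier
  binomialTerm a n d y z l = fromℕ (n C l) * pow y (d ∸ l) * pow z l * a l

  binomialTransform : (ℕ → Carrier) → ℕ → Carrier → Carrier → Carrier
  binomialTransform a n y z = sumTo n (binomialTerm a n n y z)

  binomialTransform-cong : ∀ n {a b} y z → (∀ k → a k ≈ b k) →
                           binomialTransform a n y z ≈ binomialTransform b n y z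
  binomialTransform-cong n y z a≈b = sumTo-cong n (λ l → *-congˡ (a≈b l))

  binomialTransform-+ : ∀ n (a b : ℕ → Carrier) y z →
    binomialTransform (λ k → a k + b k) n y z
      ≈ binomialTransform a n y z + binomialTransform b n y z
  binomialTransform-+ n a b y z = trans
    (sumTo-cong n (λ l → distribˡ (fromℕ (n C l) * pow y (n ∸ l) * pow z l) (a l) (b l)))
    (sumTo-distrib-+ n _ _)

  binomialTransform-*ˡ : ∀ n (k : Carrier) (a : ℕ → Carrier) y z →
    binomialTransform (λ j → k * a j) n y z ≈ k * binomialTransform a n y z
  binomialTransform-*ˡ n k a y z = trans
    (sumTo-cong n (λ l → solve 3 (λ m k a → m :* (k :* a) := k :* (m :* a)) refl _ k (a l)))
    (sumTo-*ˡ n k _)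

  binomialTransform-concentrated : ∀ n {d : ℕ → Carrier} y z → (∀ k → d (suc k) ≈ 0#) →
                                   binomialTransform d n y z ≈ pow y n * d 0
  binomialTransform-concentrated zero    y z d≈0 =
    solve 1 (λ d → (con 1 :+ con 0) :* con 1 :* con 1 :* d := con 1 :* d) refl _
  binomialTransform-concentrated (suc n) {d} y z d≈0 = begin
    binomialTransform d (suc n) y z
      ≈⟨ sumTo-suc-head n _ ⟩
    binomialTerm d (suc n) (suc n) y z 0 + sumTo n (binomialTerm d (suc n) (suc n) y z ∘ suc)
      ≈⟨ +-congˡ (sumTo-zero n (λ l → trans (*-congˡ (d≈0 l)) (zeroʳ _))) ⟩
    binomialTerm d (suc n) (suc n) y z 0 + 0#
      ≈⟨ solve 2 (λ p d → (con 1 :+ con 0) :* p :* con 1 :* d :+ con 0 := p :* d) refl _ _ ⟩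
    pow y (suc n) * d 0 ∎

  binomialTerm-*ʸ : ∀ a n y z l →
                    y * binomialTerm a n n y z l ≈ binomialTerm a n (suc n) y z l
  binomialTerm-*ʸ a n y z l with l ≤? n
  ... | yes l≤n rewrite +-∸-assoc 1 l≤n =
    solve 5 (λ y m p z a → y :* (m :* p :* z :* a) := m :* (y :* p) :* z :* a) refl _ _ _ _ _
  ... | no  l≰n rewrite k>n⇒nCk≡0 (≰⇒> l≰n) =
    solve 5 (λ y p z a p′ → y :* (con 0 :* p :* z :* a) := con 0 :* p′ :* z :* a) refl _ _ _ _ _

  *ʸ-binomialTransform : ∀ a n y z →
    y * binomialTransform a n y z ≈ sumTo (suc n) (binomialTerm a n (suc n) y z)
  *ʸ-binomialTransform a n y z = begin
    y * binomialTransform a n y z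
      ≈⟨ sym (sumTo-*ˡ n y _) ⟩
    sumTo n (λ l → y * binomialTerm a n n y z l)
      ≈⟨ sumTo-cong n (binomialTerm-*ʸ a n y z) ⟩
    sumTo n (binomialTerm a n (suc n) y z)
      ≈⟨ sym (+-identityʳ _) ⟩
    sumTo n (binomialTerm a n (suc n) y z) + 0#
      ≈⟨ +-congˡ (sym vanishing) ⟩
    sumTo (suc n) (binomialTerm a n (suc n) y z) ∎
    where
    vanishing : binomialTerm a n (suc n) y z (suc n) ≈ 0#
    vanishing rewrite k>n⇒nCk≡0 (n<1+n n) =
      solve 3 (λ p z a → con 0 :* p :* z :* a := con 0) refl _ _ _

  binomialTerm-pascal : ∀ a n y z j →
    binomialTerm a (suc n) (suc n) y z (suc j)
      ≈ z * binomialTerm (a ∘ suc) n n y z j + binomialTerm a n (suc n) y z (suc j)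
  binomialTerm-pascal a n y z j = begin
    fromℕ (suc n C suc j) * pow y (n ∸ j) * pow z (suc j) * a (suc j)
      ≡⟨ ≡.cong (λ m → fromℕ m * pow y (n ∸ j) * pow z (suc j) * a (suc j))
                (≡.sym (nCk+nC[k+1]≡[n+1]C[k+1] n j)) ⟩
    fromℕ (n C j ℕ.+ n C suc j) * pow y (n ∸ j) * pow z (suc j) * a (suc j)
      ≈⟨ *-congʳ (*-congʳ (*-congʳ (fromℕ-+ (n C j) (n C suc j)))) ⟩
    (fromℕ (n C j) + fromℕ (n C suc j)) * pow y (n ∸ j) * (z * pow z j) * a (suc j)
      ≈⟨ solve 6 (λ m₁ m₂ p z zʲ b → (m₁ :+ m₂) :* p :* (z :* zʲ) :* b
                   := z :* (m₁ :* p :* zʲ :* b) :+ m₂ :* p :* (z :* zʲ) :* b) refl _ _ _ _ _ _ ⟩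
    z * binomialTerm (a ∘ suc) n n y z j + binomialTerm a n (suc n) y z (suc j) ∎

  binomialTransform-suc : ∀ n a y z →
    binomialTransform a (suc n) y z
      ≈ y * binomialTransform a n y z + z * binomialTransform (a ∘ suc) n y z
  binomialTransform-suc n a y z = begin
    binomialTransform a (suc n) y z
      ≈⟨ sumTo-suc-head n _ ⟩
    W 0 + sumTo n (T ∘ suc)
      ≈⟨ +-congˡ (sumTo-cong n (binomialTerm-pascal a n y z)) ⟩
    W 0 + sumTo n (λ j → z * binomialTerm (a ∘ suc) n n y z j + W (suc j))
      ≈⟨ +-congˡ (sumTo-distrib-+ n _ _) ⟩
    W 0 + (sumTo n (λ j → z * binomialTerm (a ∘ suc) n n y z j) + sumTo n (W ∘ suc))
      ≈⟨ solve 3 (λ w x u → w :+ (x :+ u) := (w :+ u) :+ x) refl _ _ _ ⟩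
    (W 0 + sumTo n (W ∘ suc)) + sumTo n (λ j → z * binomialTerm (a ∘ suc) n n y z j)
      ≈⟨ +-cong (sym (sumTo-suc-head n W)) (sumTo-*ˡ n z _) ⟩
    sumTo (suc n) W + z * binomialTransform (a ∘ suc) n y z
      ≈⟨ +-congʳ (sym (*ʸ-binomialTransform a n y z)) ⟩
    y * binomialTransform a n y z + z * binomialTransform (a ∘ suc) n y z ∎
    where
    T W : ℕ → Carrier
    T = binomialTerm a (suc n) (suc n) y z
    W = binomialTerm a n (suc n) y z

  binomialTransform-compose : ∀ n a y z u v →
    binomialTransform (λ k → binomialTransform a k y z) n u v
      ≈ binomialTransform a n (u + v * y) (v * z)
  binomialTransform-compose zero a y z u v =
    solve 1 (λ b → (con 1 :+ con 0) :* con 1 :* con 1 :* ((con 1 :+ con 0) :* con 1 :* con 1 :* b)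
                 := (con 1 :+ con 0) :* con 1 :* con 1 :* b) refl (a 0)
  binomialTransform-compose (suc m) a y z u v = begin
    F b (suc m) u v
      ≈⟨ binomialTransform-suc m b u v ⟩
    u * F b m u v + v * F (b ∘ suc) m u v
      ≈⟨ +-congˡ (*-congˡ (binomialTransform-cong m u v (λ k → binomialTransform-suc k a y z))) ⟩
    u * F b m u v + v * F (λ k → y * b k + z * b′ k) m u v
      ≈⟨ +-congˡ (*-congˡ (binomialTransform-+ m _ _ u v)) ⟩
    u * F b m u v + v * (F (λ k → y * b k) m u v + F (λ k → z * b′ k) m u v)
      ≈⟨ +-congˡ (*-congˡ (+-cong (binomialTransform-*ˡ m y b u v) (binomialTransform-*ˡ m z b′ u v))) ⟩
    u * F b m u v + v * (y * F b m u v + z * F b′ m u v)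
      ≈⟨ +-cong (*-congˡ IH) (*-congˡ (+-cong (*-congˡ IH) (*-congˡ IH′))) ⟩
    u * X + v * (y * X + z * Y)
      ≈⟨ solve 6 (λ u v y z X Y → u :* X :+ v :* (y :* X :+ z :* Y)
                   := (u :+ v :* y) :* X :+ (v :* z) :* Y) refl u v y z X Y ⟩
    (u + v * y) * X + (v * z) * Y
      ≈⟨ sym (binomialTransform-suc m a (u + v * y) (v * z)) ⟩
    F a (suc m) (u + v * y) (v * z) ∎
    where
    F = binomialTransform
    b b′ : ℕ → Carrier
    b  k = F a k y z
    b′ k = F (a ∘ suc) k y z
    X Y : Carrier
    X = F a m (u + v * y) (v * z)
    Y = F (a ∘ suc) m (u + v * y) (v * z)
    IH : F b m u v ≈ X
    IH = binomialTransform-compose m a y z u v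
    IH′ : F b′ m u v ≈ Y
    IH′ = binomialTransform-compose m (a ∘ suc) y z u v

module QEulerNumbers {c ℓ} (R : CommutativeRing c ℓ) where
  open CommutativeRing R
  open QEuler R
  open BinomialTransform R
  open import Algebra.Solver.Ring.NaturalCoefficients.Default commutativeSemiring
  open import Relation.Binary.Reasoning.Setoid setoid

  *-inverse-cancelˡ : ∀ {a a⁻¹ x y} → a * a⁻¹ ≈ 1# → a * x ≈ y → x ≈ a⁻¹ * y
  *-inverse-cancelˡ {a} {a⁻¹} {x} {y} aa⁻¹≈1 ax≈y = begin
    x               ≈⟨ sym (*-identityˡ x) ⟩
    1# * x          ≈⟨ *-congʳ (sym aa⁻¹≈1) ⟩
    a * a⁻¹ * x     ≈⟨ solve 3 (λ a b x → a :* b :* x := b :* (a :* x)) refl a a⁻¹ x ⟩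
    a⁻¹ * (a * x)   ≈⟨ *-congˡ ax≈y ⟩
    a⁻¹ * y         ∎

  *-inverse-square : ∀ {a a⁻¹} → a * a⁻¹ ≈ 1# → a * a * (a⁻¹ * a⁻¹) ≈ 1#
  *-inverse-square {a} {a⁻¹} aa⁻¹≈1 = begin
    a * a * (a⁻¹ * a⁻¹)       ≈⟨ solve 2 (λ a b → a :* a :* (b :* b) := (a :* b) :* (a :* b)) refl a a⁻¹ ⟩
    (a * a⁻¹) * (a * a⁻¹)     ≈⟨ *-cong aa⁻¹≈1 aa⁻¹≈1 ⟩
    1# * 1#                   ≈⟨ *-identityˡ 1# ⟩
    1#                        ∎

  qEulerPoly-2 : ∀ q ξ n → qEulerPoly q ξ n 2 ≈ binomialTransform ξ n (1# + q * 1#) (q * q)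
  qEulerPoly-2 q ξ n = sumTo-cong n λ l →
    *-congʳ (*-cong (*-congˡ (pow-cong (n ∸ l) (+-congʳ (+-identityˡ 1#)))) (pow-*2 q l))

  binomialTransform-1# : ∀ a k z →
    binomialTransform a k 1# z ≈ sumTo k (λ l → fromℕ (k C l) * pow z l * a l)
  binomialTransform-1# a k z = sumTo-cong k λ l →
    *-congʳ (*-congʳ (trans (*-congˡ (pow-1# (k ∸ l))) (*-identityʳ _)))

  module _ (q : Carrier) (ξ : ℕ → Carrier) (isξ : IsQEulerNumbers q ξ) where
    open Σ isξ renaming (proj₁ to ξ₀≈1; proj₂ to q*Σ+ξ≈0)

    P : ℕ → Carrier
    P k = binomialTransform ξ k 1# q

    q*P+ξ≈0 : ∀ k → 1 ≤ k → q * P k + ξ k ≈ 0#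
    q*P+ξ≈0 k 1≤k = trans (+-congʳ (*-congˡ (binomialTransform-1# ξ k q))) (q*Σ+ξ≈0 k 1≤k)

    q*P₀+ξ₀≈q+1 : q * P 0 + ξ 0 ≈ q + 1#
    q*P₀+ξ₀≈q+1 = begin
      q * ((1# + 0#) * 1# * 1# * ξ 0) + ξ 0
        ≈⟨ solve 2 (λ q x → q :* ((con 1 :+ con 0) :* con 1 :* con 1 :* x) :+ x := q :* x :+ x) refl q (ξ 0) ⟩
      q * ξ 0 + ξ 0
        ≈⟨ +-cong (trans (*-congˡ ξ₀≈1) (*-identityʳ q)) ξ₀≈1 ⟩
      q + 1# ∎

    -- Only the k = 0 term survives once q Pₖ is paired with ξₖ.
    q*transformP+P≈q+1 : ∀ n → q * binomialTransform P n 1# q + P n ≈ q + 1#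
    q*transformP+P≈q+1 n = begin
      q * binomialTransform P n 1# q + binomialTransform ξ n 1# q
        ≈⟨ sym (+-congʳ (binomialTransform-*ˡ n q P 1# q)) ⟩
      binomialTransform (λ k → q * P k) n 1# q + binomialTransform ξ n 1# q
        ≈⟨ sym (binomialTransform-+ n _ ξ 1# q) ⟩
      binomialTransform (λ k → q * P k + ξ k) n 1# q
        ≈⟨ binomialTransform-concentrated n 1# q (λ k → q*P+ξ≈0 (suc k) (s≤s z≤n)) ⟩
      pow 1# n * (q * P 0 + ξ 0)
        ≈⟨ *-cong (pow-1# n) q*P₀+ξ₀≈q+1 ⟩
      1# * (q + 1#)
        ≈⟨ *-identityˡ _ ⟩
      q + 1# ∎

    q²*qEulerPoly-2 : ∀ n → 1 ≤ n → q * q * qEulerPoly q ξ n 2 ≈ q * q + q + ξ n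
    q²*qEulerPoly-2 n 1≤n = begin
      q * q * qEulerPoly q ξ n 2
        ≈⟨ *-congˡ (qEulerPoly-2 q ξ n) ⟩
      q * q * binomialTransform ξ n (1# + q * 1#) (q * q)
        ≈⟨ *-congˡ (sym (binomialTransform-compose n ξ 1# q 1# q)) ⟩
      q * q * S
        ≈⟨ sym (+-identityʳ _) ⟩
      q * q * S + 0#
        ≈⟨ +-congˡ (sym (q*P+ξ≈0 n 1≤n)) ⟩
      q * q * S + (q * P n + ξ n)
        ≈⟨ solve 4 (λ q s p x → q :* q :* s :+ (q :* p :+ x) := q :* (q :* s :+ p) :+ x) refl q S (P n) (ξ n) ⟩
      q * (q * S + P n) + ξ n
        ≈⟨ +-congʳ (*-congˡ (q*transformP+P≈q+1 n)) ⟩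
      q * (q + 1#) + ξ n
        ≈⟨ solve 2 (λ q x → q :* (q :+ con 1) :+ x := q :* q :+ q :+ x) refl q (ξ n) ⟩
      q * q + q + ξ n ∎
      where
      S : Carrier
      S = binomialTransform P n 1# q

theorem1 : ∀ {c ℓ} (R : CommutativeRing c ℓ) →
    let open CommutativeRing R
        open QEuler R
    in (q q⁻¹ : Carrier) → q * q⁻¹ ≈ 1# →
       (ξ : ℕ → Carrier) → IsQEulerNumbers q ξ →
       (n : ℕ) → 1 ≤ n →
       qEulerPoly q ξ n 2 ≈ 1# + q⁻¹ + (q⁻¹ * q⁻¹) * ξ n
theorem1 R q q⁻¹ qq⁻¹≈1 ξ isξ n 1≤n = begin
  qEulerPoly q ξ n 2
    ≈⟨ *-inverse-cancelˡ (*-inverse-square qq⁻¹≈1) (q²*qEulerPoly-2 q ξ isξ n 1≤n) ⟩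
  q⁻¹ * q⁻¹ * (q * q + q + ξ n)
    ≈⟨ solve 3 (λ q r x → r :* r :* (q :* q :+ q :+ x)
                 := (q :* r) :* (q :* r) :+ (q :* r) :* r :+ r :* r :* x) refl q q⁻¹ (ξ n) ⟩
  (q * q⁻¹) * (q * q⁻¹) + (q * q⁻¹) * q⁻¹ + q⁻¹ * q⁻¹ * ξ n
    ≈⟨ +-congʳ (+-cong (*-cong qq⁻¹≈1 qq⁻¹≈1) (*-congʳ qq⁻¹≈1)) ⟩
  1# * 1# + 1# * q⁻¹ + q⁻¹ * q⁻¹ * ξ n
    ≈⟨ +-congʳ (+-cong (*-identityˡ 1#) (*-identityˡ q⁻¹)) ⟩
  1# + q⁻¹ + q⁻¹ * q⁻¹ * ξ n ∎
  where
  open CommutativeRing R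
  open QEuler R
  open QEulerNumbers R
  open import Algebra.Solver.Ring.NaturalCoefficients.Default commutativeSemiring
  open import Relation.Binary.Reasoning.Setoid setoid
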